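{- For any $k\geq 4$, there does not exist a total $k$-uniform connected chordal graph.
   Context: All graphs are finite and simple. A graph is chordal if it has no induced cycle of length at least 4. $N(v)$ is the set of neighbors of $v$. For a graph $G$ with no isolated vertices, a total dominating set is a set $A\subseteq V(G)$ such that every vertex of $G$ has a neighbor in $A$; $\gamma_t(G)$ is the minimum size of one. A sequence $(v_1,\dots,v_m)$ of distinct vertices is legal if $N(v_i)\setminus\bigcup_{j=1}^{i-1}N(v_j)\neq\emptyset$ for every $i\in\{2,\dots,m\}$; it is a total dominating sequence if moreover $\{v_1,\dots,v_m\}$ is a total dominating set. $\gamma_{gr}^t(G)$ is the maximum length of a total dominating sequence. $G$ is total $k$-uniform if $\gamma_t(G)=\gamma_{gr}^t(G)=k$. -}

module Defs where

open import Data.Nat using (ℕ; zero; suc; _+_; _≤_; _%_)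
open import Data.Fin using (Fin; toℕ)
open import Data.Bool using (Bool; true; false)
open import Data.List using (List; []; _∷_; _++_; [_]; length)
open import Data.List.Membership.Propositional using (_∈_)
open import Data.List.Relation.Unary.All using (All)
open import Data.List.Relation.Unary.Unique.Propositional using (Unique)
open import Data.Product using (Σ; ∃; ∃-syntax; _×_)
open import Data.Sum using (_⊎_)
open import Data.Unit using (⊤)
open import Relation.Nullary using (¬_)
open import Relation.Binary.PropositionalEquality using (_≡_)
open import Function.Definitions using (Injective)
open import Function.Bundles using (_⇔_)

record Graph (n : ℕ) : Set where
  field
    adj   : Fin n → Fin n → Bool
    sym   : ∀ u v → adj u v ≡ adj v u
    irref : ∀ v → adj v v ≡ false

module _ {n : ℕ} (G : Graph n) where
  open Graph G

  Adj : Fin n → Fin n → Set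
  Adj u v = adj u v ≡ true

  NoIsolated : Set
  NoIsolated = ∀ v → ∃[ u ] Adj v u

  data Walk : Fin n → Fin n → Set where
    here : ∀ {v} → Walk v v
    step : ∀ {u w v} → Adj u w → Walk w v → Walk u v

  Connected : Set
  Connected = ∀ u v → Walk u v

  record InducedCycle (m : ℕ) .{{_ : Data.Nat.NonZero m}} : Set where
    field
      cyc     : Fin m → Fin n
      distinct : Injective _≡_ _≡_ cyc
      edges   : ∀ i j → Adj (cyc i) (cyc j) ⇔
                  (toℕ j ≡ suc (toℕ i) % m ⊎ toℕ i ≡ suc (toℕ j) % m)

  Chordal : Set
  Chordal = ∀ r → ¬ InducedCycle (4 + r)

  TotalDominating : List (Fin n) → Set
  TotalDominating A = ∀ v → ∃[ u ] (u ∈ A × Adj v u)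

  GammaT≡ : ℕ → Set
  GammaT≡ k = (∃[ A ] (Unique A × TotalDominating A × length A ≡ k))
            × (∀ A → Unique A → TotalDominating A → k ≤ length A)

  LegalFrom : List (Fin n) → List (Fin n) → Set
  LegalFrom prev []       = ⊤
  LegalFrom prev (v ∷ vs) =
    (∃[ w ] (Adj v w × All (λ u → ¬ Adj u w) prev)) × LegalFrom (prev ++ [ v ]) vs

  Legal : List (Fin n) → Set
  Legal []       = ⊤
  Legal (v ∷ vs) = LegalFrom [ v ] vs

  TotalDominatingSequence : List (Fin n) → Set
  TotalDominatingSequence s = Unique s × Legal s × TotalDominating s

  GammaGrT≡ : ℕ → Set
  GammaGrT≡ k = (∃[ s ] (TotalDominatingSequence s × length s ≡ k))
              × (∀ s → TotalDominatingSequence s → length s ≤ k)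

  -- total k-uniform (the invariants are only defined without isolated vertices)
  TotalUniform : ℕ → Set
  TotalUniform k = NoIsolated × GammaT≡ k × GammaGrT≡ k

-- If x is adjacent to y and N(x) ⊆ N[y], a connected total k-uniform graph with k ≥ 3 gives a
-- contradiction: if some neighbour z ≠ x of y has a neighbour w outside N[y], then (x, y, z) starts
-- a total dominating sequence in which x is redundant, so γ_gr^t > γ_t; otherwise N[y] is closed
-- under neighbours, hence by connectivity {x, y} is a total dominating set and γ_t ≤ 2.
-- Conversely every chordal graph with an edge has such a pair x, y. Grow an induced path v₀ v₁ …
-- at v₀ by a neighbour p of v₀ outside N[v₁]: were p adjacent to some v_j with j ≥ 2, the least
-- such j would close the induced cycle p v₀ … v_j of length ≥ 4. So the path stays induced, and
-- it cannot grow forever in a finite graph.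

module Submission where

open import Defs
open import Data.Nat using (ℕ; zero; suc; _+_; _≤_; _<_; z≤n; s≤s; _%_; _≤?_)
open import Data.Nat.Properties
  using ( ≤-trans; ≤-refl; ≤-pred; <⇒≱; 1+n≰n; <-irrefl; ≰⇒>; m≤n+m; m≤m+n; n≤1+n
        ; m≤n⇒m<n∨m≡n; m≤n⇒m≤1+n; +-suc; +-assoc; +-cancelˡ-≤)
open import Data.Nat.DivMod using (m<n⇒m%n≡m; n%n≡0)
open import Data.Fin using (Fin; toℕ; _≟_)
open import Data.Fin.Properties using (any?; all?; ¬∀⟶∃¬; toℕ-injective; toℕ<n; pigeonhole; <⇒≢)
open import Data.Bool using (true)
import Data.Bool as Bool
open import Data.List using (List; []; _∷_; _++_; [_]; length)
open import Data.List.Properties using (++-assoc; ++-identityʳ; length-++; length-++-sucʳ; length-tabulate)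
open import Data.List.Membership.Propositional using (_∈_; _∉_)
open import Data.List.Membership.Propositional.Properties using (∈-∃++; ∈-++⁻; ∈-++⁺ˡ; ∈-++⁺ʳ; ∈-allFin)
open import Data.List.Relation.Binary.Subset.Propositional using (_⊆_)
open import Data.List.Relation.Unary.Any using (here; there)
open import Data.List.Relation.Unary.All using (All; []; _∷_; tabulate; lookup)
open import Data.List.Relation.Unary.AllPairs using ([]; _∷_)
open import Data.List.Relation.Unary.Unique.Propositional using (Unique)
import Data.List.Relation.Unary.Unique.Propositional.Properties as Unique
open import Data.Product using (∃₂; ∃-syntax; _×_; _,_; proj₁; proj₂)
open import Data.Sum using (_⊎_; inj₁; inj₂; [_,_]′)
open import Data.Sum.Function.Propositional using (_⊎-⇔_)
open import Data.Unit using (tt)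
open import Data.Empty using (⊥; ⊥-elim)
open import Relation.Nullary using (¬_; Dec; yes; no; ¬?)
open import Relation.Nullary.Decidable using (_×-dec_; _⊎-dec_; decidable-stable)
open import Relation.Binary.PropositionalEquality using (_≡_; _≢_; refl; sym; trans; cong; subst)
open import Function.Bundles using (_⇔_; mk⇔)
open import Function.Properties.Equivalence using () renaming (sym to ⇔-sym; trans to ⇔-trans)

Unique-⊆⇒length≤ : {A : Set} {xs ys : List A} → Unique xs → xs ⊆ ys → length xs ≤ length ys
Unique-⊆⇒length≤ {xs = []} _ _ = z≤n
Unique-⊆⇒length≤ {xs = x ∷ xs} {ys} (x∉xs ∷ uniq) xs⊆ys with ∈-∃++ (xs⊆ys (here refl))
... | us , vs , refl = subst (suc (length xs) ≤_) (sym (length-++-sucʳ us x vs))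
                         (s≤s (Unique-⊆⇒length≤ uniq xs⊆us++vs))
  where
  xs⊆us++vs : xs ⊆ us ++ vs
  xs⊆us++vs {y} y∈xs with ∈-++⁻ us (xs⊆ys (there y∈xs))
  ... | inj₁ y∈us          = ∈-++⁺ˡ y∈us
  ... | inj₂ (here refl)   = ⊥-elim (lookup x∉xs y∈xs refl)
  ... | inj₂ (there y∈vs)  = ∈-++⁺ʳ us y∈vs

Unique⇒length≤ : ∀ {n} {xs : List (Fin n)} → Unique xs → length xs ≤ n
Unique⇒length≤ {n} {xs} uniq =
  subst (length xs ≤_) (length-tabulate {n = n} (λ i → i))
        (Unique-⊆⇒length≤ uniq (λ {x} _ → ∈-allFin x))

Unique-∷ʳ : {A : Set} {xs : List A} {x : A} → Unique xs → x ∉ xs → Unique (xs ++ [ x ])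
Unique-∷ʳ uniq x∉xs = Unique.++⁺ uniq ([] ∷ []) λ { (x∈xs , here refl) → x∉xs x∈xs }

Consecutive : ℕ → ℕ → Set
Consecutive i j = j ≡ suc i ⊎ i ≡ suc j

Follows : ℕ → ℕ → ℕ → Set
Follows l a b = b ≡ suc a ⊎ (a ≡ l × b ≡ 0)

sucMod⇔Follows : ∀ {l a b} → a ≤ l → b ≤ l → (b ≡ suc a % suc l) ⇔ Follows l a b
sucMod⇔Follows {l} {a} a≤l b≤l with m≤n⇒m<n∨m≡n a≤l
... | inj₁ a<l = mk⇔ (λ b≡ → inj₁ (trans b≡ 1+a%1+l≡1+a)) λ
  { (inj₁ refl)      → sym 1+a%1+l≡1+a
  ; (inj₂ (a≡l , _)) → ⊥-elim (<-irrefl a≡l a<l) }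
  where
  1+a%1+l≡1+a : suc a % suc l ≡ suc a
  1+a%1+l≡1+a = m<n⇒m%n≡m (s≤s a<l)
... | inj₂ refl = mk⇔ (λ b≡ → inj₂ (refl , trans b≡ (n%n≡0 (suc l)))) λ
  { (inj₁ refl)       → ⊥-elim (1+n≰n b≤l)
  ; (inj₂ (_ , refl)) → sym (n%n≡0 (suc l)) }

none-or-least : {P : ℕ → Set} → (∀ j → Dec (P j)) → ∀ m →
                (∀ {j} → j ≤ m → ¬ P j) ⊎ ∃[ j ] (j ≤ m × P j × ∀ {i} → i < j → ¬ P i)
none-or-least P? zero with P? 0
... | yes p0 = inj₂ (0 , z≤n , p0 , λ ())
... | no ¬p0 = inj₁ λ { z≤n → ¬p0 }
none-or-least P? (suc m) with none-or-least P? m | P? (suc m)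
... | inj₂ (j , j≤m , pj , below) | _ = inj₂ (j , m≤n⇒m≤1+n j≤m , pj , below)
... | inj₁ none | yes pm = inj₂ (suc m , ≤-refl , pm , λ i<1+m → none (≤-pred i<1+m))
... | inj₁ none | no ¬pm = inj₁ λ j≤1+m → case-≤ (m≤n⇒m<n∨m≡n j≤1+m)
  where
  case-≤ : ∀ {j} → j < suc m ⊎ j ≡ suc m → ¬ _
  case-≤ (inj₁ j<1+m) = none (≤-pred j<1+m)
  case-≤ (inj₂ refl)  = ¬pm

module _ {n : ℕ} (G : Graph n) where

  Adj-sym : ∀ {u v} → Adj G u v → Adj G v u
  Adj-sym {u} {v} uv = trans (Graph.sym G v u) uv

  Adj-irrefl : ∀ {v} → ¬ Adj G v v
  Adj-irrefl {v} vv with trans (sym vv) (Graph.irref G v)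
  ... | ()

  Adj⇒≢ : ∀ {u v} → Adj G u v → u ≢ v
  Adj⇒≢ uv refl = Adj-irrefl uv

  Adj? : ∀ u v → Dec (Adj G u v)
  Adj? u v = Graph.adj G u v Bool.≟ true

  DominatedBy? : ∀ A v → Dec (∃[ u ] (u ∈ A × Adj G v u))
  DominatedBy? A v = any? λ u → (u ∈? A) ×-dec Adj? v u
    where open import Data.List.Membership.DecPropositional (_≟_ {n}) using (_∈?_)

  TotalDominating? : ∀ A → Dec (TotalDominating G A)
  TotalDominating? A = all? (DominatedBy? A)

  LegalCompletion : List (Fin n) → Set
  LegalCompletion prev = ∃[ t ] (LegalFrom G prev t × Unique (prev ++ t) × TotalDominating G (prev ++ t))

  module _ (noIsolated : NoIsolated G) where

    ¬TotalDominating⇒footprinter : ∀ {A} → ¬ TotalDominating G A →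
      ∃[ u ] (u ∉ A × ∃[ w ] (Adj G u w × All (λ q → ¬ Adj G q w) A))
    ¬TotalDominating⇒footprinter {A} ¬td with ¬∀⟶∃¬ n _ (DominatedBy? A) ¬td
    ... | w , ¬dominated with noIsolated w
    ...   | u , wu = u , (λ u∈A → ¬dominated (u , u∈A , wu)) , w , Adj-sym wu ,
                     tabulate λ q∈A qw → ¬dominated (_ , q∈A , Adj-sym qw)

    legalCompletion-within : ∀ d prev → Unique prev → n ≤ length prev + d → LegalCompletion prev
    legalCompletion-within d prev uniq bound with TotalDominating? prev
    ... | yes td = [] , tt , subst Unique (sym (++-identityʳ prev)) uniq
                           , subst (TotalDominating G) (sym (++-identityʳ prev)) td
    ... | no ¬td with ¬TotalDominating⇒footprinter ¬td | d
    ... | u , u∉prev , footprint | zero =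
      ⊥-elim (1+n≰n (+-cancelˡ-≤ (length prev) 1 0
        (≤-trans (subst (_≤ n) (length-++ prev) (Unique⇒length≤ (Unique-∷ʳ uniq u∉prev))) bound)))
    ... | u , u∉prev , footprint | suc d
      with legalCompletion-within d (prev ++ [ u ]) (Unique-∷ʳ uniq u∉prev) bound′
      where
      bound′ : n ≤ length (prev ++ [ u ]) + d
      bound′ = subst (n ≤_) (sym (trans (cong (_+ d) (length-++ prev)) (+-assoc (length prev) 1 d))) bound
    ... | t , legal , uniq′ , td =
      u ∷ t , (footprint , legal) , subst Unique (++-assoc prev [ u ] t) uniq′
                                  , subst (TotalDominating G) (++-assoc prev [ u ] t) td

    legalCompletion : ∀ prev → Unique prev → LegalCompletion prev
    legalCompletion prev uniq = legalCompletion-within n prev uniq (m≤n+m n (length prev))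

  _∈N[_] : Fin n → Fin n → Set
  p ∈N[ y ] = p ≡ y ⊎ Adj G y p

  N_⊆N[_] : Fin n → Fin n → Set
  N x ⊆N[ y ] = ∀ {p} → Adj G x p → p ∈N[ y ]

  ∈N[]? : ∀ p y → Dec (p ∈N[ y ])
  ∈N[]? p y = (p ≟ y) ⊎-dec Adj? y p

  N⊆N[]-or-escape : ∀ x y → N x ⊆N[ y ] ⊎ ∃[ p ] (Adj G x p × ¬ p ∈N[ y ])
  N⊆N[]-or-escape x y with any? (λ p → Adj? x p ×-dec ¬? (∈N[]? p y))
  ... | yes escape = inj₂ escape
  ... | no ¬escape = inj₁ λ {p} xp → decidable-stable (∈N[]? p y) λ p∉ → ¬escape (p , xp , p∉)

  dominated-head-redundant : ∀ {x y z s} → N x ⊆N[ y ] → y ∈ s → Adj G y z → z ∈ s →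
                             TotalDominating G (x ∷ s) → TotalDominating G s
  dominated-head-redundant {x} {y} {z} x⊆y y∈s yz z∈s td v with td v
  ... | u , there u∈s , vu = u , u∈s , vu
  ... | .x , here refl , vx with x⊆y (Adj-sym vx)
  ...   | inj₁ refl = z , z∈s , yz
  ...   | inj₂ yv   = y , y∈s , Adj-sym yv

  N[]-closed⇒dominating-pair : Connected G → ∀ {x y} → Adj G y x →
                               (∀ {u} → u ∈N[ y ] → N u ⊆N[ y ]) → TotalDominating G (y ∷ x ∷ [])
  N[]-closed⇒dominating-pair connected {x} {y} yx closed v with reach (connected y v) (inj₁ refl)
    where
    reach : ∀ {u v} → Walk G u v → u ∈N[ y ] → v ∈N[ y ]
    reach here           u∈N[y] = u∈N[y]
    reach (step uw walk) u∈N[y] = reach walk (closed u∈N[y] uw)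
  ... | inj₁ refl = x , there (here refl) , yx
  ... | inj₂ yv   = y , here refl , Adj-sym yv

  module _ {k} (uniform : TotalUniform G k) where
    private
      γₜ-minimal : ∀ A → Unique A → TotalDominating G A → k ≤ length A
      γₜ-minimal = proj₂ (proj₁ (proj₂ uniform))

      γₜgr-maximal : ∀ s → TotalDominatingSequence G s → length s ≤ k
      γₜgr-maximal = proj₂ (proj₂ (proj₂ uniform))

    redundant-head⇒⊥ : ∀ {x s} → TotalDominatingSequence G (x ∷ s) → TotalDominating G s → ⊥
    redundant-head⇒⊥ {s = s} tds@(_ ∷ uniq , _) td =
      1+n≰n (≤-trans (γₜgr-maximal _ tds) (γₜ-minimal s uniq td))

    -- z footprints w, so (x, y, z) is legal, and N(x) ⊆ N[y] makes x redundant in every completion.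
    escape⇒⊥ : ∀ {x y z w} → Adj G x y → N x ⊆N[ y ] →
               Adj G y z → z ≢ x → Adj G z w → ¬ w ∈N[ y ] → ⊥
    escape⇒⊥ {x} {y} {z} {w} xy x⊆y yz z≢x zw w∉N[y]
      with legalCompletion (proj₁ uniform) (x ∷ y ∷ z ∷ []) prefix-unique
      where
      prefix-unique : Unique (x ∷ y ∷ z ∷ [])
      prefix-unique = (Adj⇒≢ xy ∷ (λ x≡z → z≢x (sym x≡z)) ∷ []) ∷ (Adj⇒≢ yz ∷ []) ∷ [] ∷ []
    ... | t , legal , uniq , td =
      redundant-head⇒⊥ (uniq , (x-footprint , w-footprint , legal) , td)
                       (dominated-head-redundant x⊆y (here refl) yz (there (here refl)) td)
      where
      x-footprint : ∃[ v ] (Adj G y v × All (λ q → ¬ Adj G q v) [ x ])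
      x-footprint = x , Adj-sym xy , Adj-irrefl ∷ []
      w-footprint : ∃[ v ] (Adj G z v × All (λ q → ¬ Adj G q v) (x ∷ y ∷ []))
      w-footprint = w , zw , (λ xw → w∉N[y] (x⊆y xw)) ∷ (λ yw → w∉N[y] (inj₂ yw)) ∷ []

    connected⇒¬N⊆N[] : Connected G → 3 ≤ k → ∀ {x y} → Adj G x y → ¬ N x ⊆N[ y ]
    connected⇒¬N⊆N[] connected 3≤k {x} {y} xy x⊆y =
      <⇒≱ 3≤k (γₜ-minimal (y ∷ x ∷ []) pair-unique
                (N[]-closed⇒dominating-pair connected (Adj-sym xy) closed))
      where
      pair-unique : Unique (y ∷ x ∷ [])
      pair-unique = ((λ y≡x → Adj⇒≢ xy (sym y≡x)) ∷ []) ∷ [] ∷ []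
      closed : ∀ {u} → u ∈N[ y ] → N u ⊆N[ y ]
      closed (inj₁ refl) yp = inj₂ yp
      closed {u} (inj₂ yu) with u ≟ x | N⊆N[]-or-escape u y
      ... | yes refl | _                    = x⊆y
      ... | no u≢x   | inj₁ u⊆y             = u⊆y
      ... | no u≢x   | inj₂ (w , uw , w∉N[y]) = ⊥-elim (escape⇒⊥ xy x⊆y yu u≢x uw w∉N[y])

  record InducedPath (m : ℕ) : Set where
    field
      vertex          : ℕ → Fin n
      injective       : ∀ {i j} → i ≤ m → j ≤ m → vertex i ≡ vertex j → i ≡ j
      adj⇒consecutive : ∀ {i j} → i ≤ m → j ≤ m → Adj G (vertex i) (vertex j) → Consecutive i j
      consecutive-adj : ∀ {i} → i < m → Adj G (vertex i) (vertex (suc i))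

  open InducedPath

  singleVertexPath : Fin n → InducedPath 0
  singleVertexPath v = record
    { vertex          = λ _ → v
    ; injective       = λ { z≤n z≤n _ → refl }
    ; adj⇒consecutive = λ _ _ vv → ⊥-elim (Adj-irrefl vv)
    ; consecutive-adj = λ () }

  restrict : ∀ {m j} → j ≤ m → InducedPath m → InducedPath j
  restrict j≤m P = record
    { vertex          = vertex P
    ; injective       = λ a≤j b≤j → injective P (≤-trans a≤j j≤m) (≤-trans b≤j j≤m)
    ; adj⇒consecutive = λ a≤j b≤j → adj⇒consecutive P (≤-trans a≤j j≤m) (≤-trans b≤j j≤m)
    ; consecutive-adj = λ a<j → consecutive-adj P (≤-trans a<j j≤m) }

  InducedPath⇒length<n : ∀ {m} → InducedPath m → m < n
  InducedPath⇒length<n {m} P with suc m ≤? n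
  ... | yes m<n = m<n
  ... | no m≮n with pigeonhole (≰⇒> m≮n) (λ i → vertex P (toℕ i))
  ...   | i , j , i<j , vᵢ≡vⱼ =
    ⊥-elim (<⇒≢ i<j (toℕ-injective (injective P (≤-pred (toℕ<n i)) (≤-pred (toℕ<n j)) vᵢ≡vⱼ)))

  inducedCycle : ∀ l (g : ℕ → Fin n) →
                 (∀ {a b} → a ≤ l → b ≤ l → g a ≡ g b → a ≡ b) →
                 (∀ {a b} → a ≤ l → b ≤ l → Adj G (g a) (g b) ⇔ (Follows l a b ⊎ Follows l b a)) →
                 InducedCycle G (suc l)
  inducedCycle l g injective adj⇔follows = record
    { cyc      = λ i → g (toℕ i)
    ; distinct = λ {i} {j} gᵢ≡gⱼ → toℕ-injective (injective (index≤l i) (index≤l j) gᵢ≡gⱼ)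
    ; edges    = λ i j → ⇔-trans (adj⇔follows (index≤l i) (index≤l j))
                   (⇔-sym (sucMod⇔Follows (index≤l i) (index≤l j)
                            ⊎-⇔ sucMod⇔Follows (index≤l j) (index≤l i))) }
    where
    index≤l : (i : Fin (suc l)) → toℕ i ≤ l
    index≤l i = ≤-pred (toℕ<n i)

  _◂_ : Fin n → (ℕ → Fin n) → ℕ → Fin n
  (p ◂ f) zero    = p
  (p ◂ f) (suc i) = f i

  module _ {m} (P : InducedPath m) {p} (p∉P : ∀ {i} → i ≤ m → p ≢ vertex P i)
           (v₀p : Adj G (vertex P 0) p) where

    private
      g : ℕ → Fin n
      g = p ◂ vertex P

    ◂-injective : ∀ {a b} → a ≤ suc m → b ≤ suc m → g a ≡ g b → a ≡ b
    ◂-injective {zero}  {zero}  _   _   _   = refl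
    ◂-injective {zero}  {suc b} _   b≤m p≡ = ⊥-elim (p∉P (≤-pred b≤m) p≡)
    ◂-injective {suc a} {zero}  a≤m _   ≡p = ⊥-elim (p∉P (≤-pred a≤m) (sym ≡p))
    ◂-injective {suc a} {suc b} a≤m b≤m e  = cong suc (injective P (≤-pred a≤m) (≤-pred b≤m) e)

    ◂-consecutive-adj : ∀ {a} → a < suc m → Adj G (g a) (g (suc a))
    ◂-consecutive-adj {zero}  _   = Adj-sym v₀p
    ◂-consecutive-adj {suc a} a<m = consecutive-adj P (≤-pred a<m)

    ◂-adj⇒consecutive : ∀ {a b} → a ≤ m → b ≤ m → Adj G (g (suc a)) (g (suc b)) →
                        Consecutive (suc a) (suc b)
    ◂-adj⇒consecutive a≤m b≤m ab with adj⇒consecutive P a≤m b≤m ab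
    ... | inj₁ b≡1+a = inj₁ (cong suc b≡1+a)
    ... | inj₂ a≡1+b = inj₂ (cong suc a≡1+b)

    prepend : (∀ {i} → i ≤ m → Adj G p (vertex P i) → i ≡ 0) → InducedPath (suc m)
    prepend only-v₀ = record
      { vertex          = g
      ; injective       = ◂-injective
      ; adj⇒consecutive = adj
      ; consecutive-adj = ◂-consecutive-adj }
      where
      adj : ∀ {a b} → a ≤ suc m → b ≤ suc m → Adj G (g a) (g b) → Consecutive a b
      adj {zero}  {zero}  _   _   pp = ⊥-elim (Adj-irrefl pp)
      adj {zero}  {suc b} _   b≤m pb = inj₁ (cong suc (only-v₀ (≤-pred b≤m) pb))
      adj {suc a} {zero}  a≤m _   ap = inj₂ (cong suc (only-v₀ (≤-pred a≤m) (Adj-sym ap)))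
      adj {suc a} {suc b} a≤m b≤m ab = ◂-adj⇒consecutive (≤-pred a≤m) (≤-pred b≤m) ab

    close-cycle : ∀ {r} → m ≡ 2 + r → Adj G p (vertex P m) →
                  (∀ {i} → i ≤ m → Adj G p (vertex P i) → i ≡ 0 ⊎ i ≡ m) → InducedCycle G (4 + r)
    close-cycle refl pvₘ only-ends = inducedCycle (suc m) g ◂-injective
      λ a≤ b≤ → mk⇔ (adj⇒follows a≤ b≤)
                    [ follows⇒adj a≤ b≤ , (λ ba → Adj-sym (follows⇒adj b≤ a≤ ba)) ]′
      where
      adj⇒follows : ∀ {a b} → a ≤ suc m → b ≤ suc m → Adj G (g a) (g b) →
                    Follows (suc m) a b ⊎ Follows (suc m) b a
      adj⇒follows {zero}  {zero}  _   _   pp = ⊥-elim (Adj-irrefl pp)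
      adj⇒follows {zero}  {suc b} _   b≤m pb with only-ends (≤-pred b≤m) pb
      ... | inj₁ refl = inj₁ (inj₁ refl)
      ... | inj₂ refl = inj₂ (inj₂ (refl , refl))
      adj⇒follows {suc a} {zero}  a≤m _   ap with only-ends (≤-pred a≤m) (Adj-sym ap)
      ... | inj₁ refl = inj₂ (inj₁ refl)
      ... | inj₂ refl = inj₁ (inj₂ (refl , refl))
      adj⇒follows {suc a} {suc b} a≤m b≤m ab with ◂-adj⇒consecutive (≤-pred a≤m) (≤-pred b≤m) ab
      ... | inj₁ b≡1+a = inj₁ (inj₁ b≡1+a)
      ... | inj₂ a≡1+b = inj₂ (inj₁ a≡1+b)

      follows⇒adj : ∀ {a b} → a ≤ suc m → b ≤ suc m → Follows (suc m) a b → Adj G (g a) (g b)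
      follows⇒adj _ b≤ (inj₁ refl)         = ◂-consecutive-adj b≤
      follows⇒adj _ _  (inj₂ (refl , refl)) = Adj-sym pvₘ

  escape∉path : ∀ {m} (P : InducedPath (suc m)) {p} → Adj G (vertex P 0) p → ¬ p ∈N[ vertex P 1 ] →
                ∀ {i} → i ≤ suc m → p ≢ vertex P i
  escape∉path P v₀p p∉N[v₁] i≤m refl with adj⇒consecutive P z≤n i≤m v₀p
  ... | inj₁ refl = p∉N[v₁] (inj₁ refl)

  DominatedEdge : Set
  DominatedEdge = ∃₂ λ x y → Adj G x y × N x ⊆N[ y ]

  module _ (chordal : Chordal G) where

    escape-extends : ∀ {m} (P : InducedPath (suc m)) {p} → Adj G (vertex P 0) p → ¬ p ∈N[ vertex P 1 ] →
                     InducedPath (suc (suc m))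
    escape-extends {m} P {p} v₀p p∉N[v₁] with none-or-least FarNeighbour? (suc m)
      where
      FarNeighbour : ℕ → Set
      FarNeighbour j = 2 ≤ j × Adj G p (vertex P j)
      FarNeighbour? : ∀ j → Dec (FarNeighbour j)
      FarNeighbour? j = (2 ≤? j) ×-dec Adj? p (vertex P j)
    ... | inj₁ none = prepend P (escape∉path P v₀p p∉N[v₁]) v₀p only-v₀
      where
      only-v₀ : ∀ {i} → i ≤ suc m → Adj G p (vertex P i) → i ≡ 0
      only-v₀ {zero}        _   _   = refl
      only-v₀ {suc zero}    _   pv₁ = ⊥-elim (p∉N[v₁] (inj₂ (Adj-sym pv₁)))
      only-v₀ {suc (suc i)} i≤m pvᵢ = ⊥-elim (none i≤m (s≤s (s≤s z≤n) , pvᵢ))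
    ... | inj₂ (suc (suc r) , j≤m , (_ , pvⱼ) , nearer) =
      ⊥-elim (chordal r (close-cycle (restrict j≤m P)
                                     (λ i≤j → escape∉path P v₀p p∉N[v₁] (≤-trans i≤j j≤m))
                                     v₀p refl pvⱼ only-ends))
      where
      only-ends : ∀ {i} → i ≤ suc (suc r) → Adj G p (vertex P i) → i ≡ 0 ⊎ i ≡ suc (suc r)
      only-ends {zero}        _   _   = inj₁ refl
      only-ends {suc zero}    _   pv₁ = ⊥-elim (p∉N[v₁] (inj₂ (Adj-sym pv₁)))
      only-ends {suc (suc i)} i≤j pvᵢ with m≤n⇒m<n∨m≡n i≤j
      ... | inj₁ i<j = ⊥-elim (nearer i<j (s≤s (s≤s z≤n) , pvᵢ))
      ... | inj₂ i≡j = inj₂ i≡j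
    ... | inj₂ (zero , _ , (() , _) , _)
    ... | inj₂ (suc zero , _ , (s≤s () , _) , _)

    extend-or-dominated : ∀ {m} → InducedPath (suc m) → InducedPath (suc (suc m)) ⊎ DominatedEdge
    extend-or-dominated P with N⊆N[]-or-escape (vertex P 0) (vertex P 1)
    ... | inj₁ v₀⊆v₁             = inj₂ (_ , _ , consecutive-adj P (s≤s z≤n) , v₀⊆v₁)
    ... | inj₂ (_ , v₀p , p∉N[v₁]) = inj₁ (escape-extends P v₀p p∉N[v₁])

    dominated-edge-within : ∀ d {m} → InducedPath (suc m) → n ≤ d + suc m → DominatedEdge
    dominated-edge-within zero    P bound = ⊥-elim (<⇒≱ (InducedPath⇒length<n P) bound)
    dominated-edge-within (suc d) {m} P bound with extend-or-dominated P
    ... | inj₁ P′   = dominated-edge-within d P′ (subst (n ≤_) (sym (+-suc d (suc m))) bound)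
    ... | inj₂ edge = edge

    chordal⇒dominated-edge : ∀ {a b} → Adj G a b → DominatedEdge
    chordal⇒dominated-edge {a} {b} ab = dominated-edge-within n edge (m≤m+n n 1)
      where
      edge : InducedPath 1
      edge = prepend (singleVertexPath a) (λ { z≤n b≡a → Adj⇒≢ ab (sym b≡a) }) ab λ { z≤n _ → refl }

theorem5p2 : ∀ (k : ℕ) → 4 ≤ k → ∀ (n : ℕ) (G : Graph n) →
    Connected G → Chordal G → ¬ TotalUniform G k
theorem5p2 k 4≤k zero G _ _ (_ , (_ , γₜ-minimal) , _) with ≤-trans 4≤k (γₜ-minimal [] [] λ ())
... | ()
theorem5p2 k 4≤k (suc n) G connected chordal uniform@(noIsolated , _)
  with chordal⇒dominated-edge G chordal (proj₂ (noIsolated Data.Fin.zero))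
... | x , y , xy , x⊆y = connected⇒¬N⊆N[] G uniform connected (≤-trans (n≤1+n 3) 4≤k) xy x⊆y
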